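{- Let $K$ be a simplicial complex on a nonempty finite vertex set $V$. Then $K$ is eulerian if and only if for every nonempty $I\subseteq V$, either the induced subcomplex $K|_I$ is a simplex or $\zeta_{\mathbf K}^{ -1}(K|_I)=0$.
   Context: A simplicial complex $K$ on a finite vertex set $V$ is a family of subsets of $V$ closed under taking subsets, containing $\{v\}$ for every $v\in V$. The induced subcomplex on $I\subseteq V$ is $K|_I=\{\sigma\in K:\sigma\subseteq I\}$. $K$ is a simplex if $K$ is the family of all subsets of $V$ (including the case $V=\emptyset$). Let $\zeta_{\mathbf K}(K)=1$ if $K$ is a simplex and $0$ otherwise, $\epsilon(K)=1$ if $V=\emptyset$ and $0$ otherwise. Define $\zeta_{\mathbf K}^{ -1}(K)=\sum_{k\ge0}(-1)^k\#\{(I_1,\dots,I_k): I_1\sqcup\dots\sqcup I_k=V,\ I_j\ne\emptyset,\ K|_{I_j}\text{ a simplex for all }j\}$, and the Euler character $\chi_{\mathbf K}(K)=\sum_{I\subseteq V}(-1)^{|I|}\zeta_{\mathbf K}(K|_I)\zeta_{\mathbf K}(K|_{V\setminus I})$. $K$ is eulerian if $\chi_{\mathbf K}(K|_I)=\epsilon(K|_I)$ for all $I\subseteq V$. -}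

module Defs where

open import Data.Bool using (Bool; true; false)
open import Data.Nat using (ℕ; zero; suc)
open import Data.Integer using (ℤ; +_; -_; _+_; _*_; 0ℤ; 1ℤ)
open import Data.Fin using (Fin)
open import Data.Fin.Subset using (Subset; _⊆_; _∈_; ⁅_⁆; _∩_; _∪_; _─_; ⊥; Nonempty; ∣_∣)
open import Data.Fin.Subset.Properties using (_⊆?_; anySubset?; nonempty?)
open import Data.List using (List; []; _∷_; filter; length; map; concatMap; foldr; upTo)
open import Data.Vec using (Vec; []; _∷_; toList)
import Data.Vec.Properties as VecP
import Data.Bool.Properties as BoolP
open import Data.List.Relation.Unary.All using (All; all?)
open import Data.List.Relation.Unary.AllPairs using (AllPairs; allPairs?)
open import Data.Product using (_×_; _,_; ∃)
open import Data.Product.Properties using ()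
open import Relation.Nullary using (Dec; yes; no; ¬_; does; ¬?)
open import Relation.Nullary.Decidable using (_×-dec_; decidable-stable)
open import Relation.Binary.PropositionalEquality using (_≡_; refl)
open import Relation.Unary using (Pred)
open import Level using (0ℓ)

record SimplicialComplex (n : ℕ) : Set₁ where
  field
    Face       : Subset n → Set
    face?      : (σ : Subset n) → Dec (Face σ)
    downClosed : ∀ {σ τ} → σ ⊆ τ → Face τ → Face σ
    singletons : ∀ (v : Fin n) → Face ⁅ v ⁆

open SimplicialComplex public

-- Induced subcomplexes are represented by their vertex set I ⊆ V:
-- K|_I = { σ ∈ K : σ ⊆ I }, on the vertex set I.
-- K|_I is a simplex iff every subset of I is a face of K|_I.

IsSimplex : ∀ {n} → SimplicialComplex n → Subset n → Set
IsSimplex K I = ∀ σ → σ ⊆ I → Face K σ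

isSimplex? : ∀ {n} (K : SimplicialComplex n) (I : Subset n) → Dec (IsSimplex K I)
isSimplex? K I with anySubset? (λ σ → (σ ⊆? I) ×-dec ¬? (face? K σ))
... | yes (σ , σ⊆I , ¬f) = no (λ s → ¬f (s σ σ⊆I))
... | no ¬ex = yes (λ σ σ⊆I → decidable-stable (face? K σ) (λ ¬f → ¬ex (σ , σ⊆I , ¬f)))

ζK : ∀ {n} → SimplicialComplex n → Subset n → ℤ
ζK K I with isSimplex? K I
... | yes _ = 1ℤ
... | no  _ = 0ℤ

εK : ∀ {n} → Subset n → ℤ
εK I with nonempty? I
... | yes _ = 0ℤ
... | no  _ = 1ℤ

allSubsets : (n : ℕ) → List (Subset n)
allSubsets zero    = [] ∷ []
allSubsets (suc n) = concatMap (λ p → (true ∷ p) ∷ (false ∷ p) ∷ []) (allSubsets n)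

allTuples : (n k : ℕ) → List (Vec (Subset n) k)
allTuples n zero    = [] ∷ []
allTuples n (suc k) = concatMap (λ J → map (J ∷_) (allTuples n k)) (allSubsets n)

_≟ˢ_ : ∀ {n} (p q : Subset n) → Dec (p ≡ q)
_≟ˢ_ = VecP.≡-dec BoolP._≟_

sumℤ : List ℤ → ℤ
sumℤ = foldr _+_ 0ℤ

sign : ℕ → ℤ
sign zero    = 1ℤ
sign (suc m) = - sign m

Disjoint : ∀ {n} → Subset n → Subset n → Set
Disjoint p q = p ∩ q ≡ ⊥

IsSimplexPartition : ∀ {n k} → SimplicialComplex n → Subset n → Vec (Subset n) k → Set
IsSimplexPartition K I Is =
  All Nonempty (toList Is) ×
  AllPairs Disjoint (toList Is) ×
  foldr _∪_ ⊥ (toList Is) ≡ I ×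
  All (IsSimplex K) (toList Is)

isSimplexPartition? : ∀ {n k} (K : SimplicialComplex n) (I : Subset n)
                      (Is : Vec (Subset n) k) → Dec (IsSimplexPartition K I Is)
isSimplexPartition? K I Is =
  all? nonempty? (toList Is) ×-dec
  allPairs? (λ p q → (p ∩ q) ≟ˢ ⊥) (toList Is) ×-dec
  (foldr _∪_ ⊥ (toList Is) ≟ˢ I) ×-dec
  all? (isSimplex? K) (toList Is)

numPartitions : ∀ {n} → SimplicialComplex n → Subset n → ℕ → ℕ
numPartitions {n} K I k = length (filter (isSimplexPartition? K I) (allTuples n k))

-- ζ_K^{-1}(K|_I) = Σ_{k ≥ 0} (-1)^k #{ordered simplex partitions with k blocks}.
-- Blocks are nonempty and disjoint, so terms with k > n vanish; the sum
-- is taken over k = 0, …, n.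
ζKinv : ∀ {n} → SimplicialComplex n → Subset n → ℤ
ζKinv {n} K I = sumℤ (map (λ k → sign k * (+ numPartitions K I k)) (upTo (suc n)))

χK : ∀ {n} → SimplicialComplex n → Subset n → ℤ
χK {n} K I =
  sumℤ (map (λ J → sign ∣ J ∣ * (ζK K J * ζK K (I ─ J)))
           (filter (λ J → J ⊆? I) (allSubsets n)))

Eulerian : ∀ {n} → SimplicialComplex n → Set
Eulerian K = ∀ I → χK K I ≡ εK I

-- View ζ, ζ⁻¹, χ and ε (written δ) in the subset-convolution algebra of integer functions on
-- the subsets of V, where (f ⊛ g)(I) = Σ_{J ⊆ I} f(J) g(I ∖ J). Write ζ = δ + ζ⁺ with ζ⁺ the
-- indicator of nonempty simplices. Ordered simplex partitions into k blocks are counted by the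
-- k-th convolution power of ζ⁺, which vanishes for k > |V|, so ζ ⊛ Σ_{k ≤ |V|} (-1)^k ζ⁺^k
-- telescopes to δ: ζ⁻¹ is the convolution inverse of ζ. On the other hand χ = ζ̄ ⊛ ζ with
-- ζ̄(J) = (-1)^|J| ζ(J), so K is eulerian iff ζ̄ = ζ⁻¹. The two agree on simplices by the
-- binomial identity, and ζ̄ vanishes off simplices; hence ζ̄ = ζ⁻¹ says exactly that ζ⁻¹
-- vanishes on every non-simplex.
module Submission where

open import Defs
import Data.Integer.Properties as ℤ
open import Algebra.Properties.CommutativeSemigroup ℤ.+-commutativeSemigroup
  using () renaming (interchange to +-interchange)
open import Algebra.Properties.CommutativeSemigroup ℤ.*-commutativeSemigroup
  using () renaming (x∙yz≈y∙xz to *-swapˡ)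
open import Data.Bool using (true; false; if_then_else_)
open import Data.Empty using (⊥-elim)
open import Data.Fin using (zero; suc)
open import Data.Fin.Subset
  using (Subset; Nonempty; Empty; inside; outside; _⊆_; _∈_; ⊥; ∣_∣; _─_; _∪_)
open import Data.Fin.Subset.Properties
  using (_⊆?_; nonempty?; ∉⊥; ⊥⊆; out⊆; s⊆s; drop-∷-⊆; ⊆-trans; ⊆-antisym; Empty-unique;
         p⊆p∪q; q⊆p∪q; ∣p∣≤n; x∈p∩q⁺; p∩q≢∅⇒∣p─q∣<∣p∣; ∩-zeroʳ; ∩-distribˡ-∪; ∪-identityˡ)
open import Data.Integer using (ℤ; +_; -_; _+_; _-_; _*_; 0ℤ; 1ℤ; -1ℤ)
open import Data.Integer.Tactic.RingSolver using (solve-∀)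
open import Data.List using (List; []; _∷_; map; foldr; filter; length; concatMap; upTo; _++_; _∷ʳ_)
open import Data.List.Properties
  using (filter-++; length-++; filter-accept; filter-reject; filter-none; upTo-∷ʳ)
open import Data.List.Relation.Unary.All using (All; []; _∷_; universal)
open import Data.List.Relation.Unary.All.Properties using (map⁺)
open import Data.List.Relation.Unary.AllPairs using ([]; _∷_)
open import Data.Nat using (ℕ; zero; suc; _<_; s≤s)
import Data.Nat as ℕ
open import Data.Nat.Properties using (<-≤-trans; ≤-pred)
open import Data.Product using (_×_; _,_; proj₁; proj₂)
open import Data.Sum using (_⊎_; inj₁; inj₂)
open import Data.Vec using (Vec; []; _∷_; here; there; toList)
open import Data.Vec.Properties using (∷-injectiveʳ)
open import Function using (_∘_)
open import Relation.Binary.PropositionalEquality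
  using (_≡_; refl; sym; trans; cong; cong₂; subst; module ≡-Reasoning)
open import Relation.Nullary using (Dec; yes; no; does; ¬_)
open import Relation.Nullary.Decidable using (_×-dec_; toSum)
open import Relation.Unary using (Pred; Decidable)
open import Level using (0ℓ)

open ≡-Reasoning

SubsetFn : ℕ → Set
SubsetFn m = Subset m → ℤ

headIn headOut : ∀ {m} → SubsetFn (suc m) → SubsetFn m
headIn  f J = f (inside ∷ J)
headOut f J = f (outside ∷ J)

infixl 6 _⊕_
_⊕_ : ∀ {m} → SubsetFn m → SubsetFn m → SubsetFn m
(f ⊕ g) J = f J + g J

infixr 8 _·_
_·_ : ∀ {m} → ℤ → SubsetFn m → SubsetFn m
(a · g) J = a * g J

-- (f ⊛ g) I = Σ_{J ⊆ I} f J * g (I ─ J) (see ⊛-as-sum), computed by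
-- deciding whether the first vertex of I goes to J or to I ─ J.
infixl 7 _⊛_
_⊛_ : ∀ {m} → SubsetFn m → SubsetFn m → SubsetFn m
_⊛_ {zero} f g []       = f [] * g []
_⊛_ {suc m} f g (inside  ∷ I) = (headIn f ⊛ headOut g) I + (headOut f ⊛ headIn g) I
_⊛_ {suc m} f g (outside ∷ I) = (headOut f ⊛ headOut g) I

δ : ∀ {m} → SubsetFn m
δ {zero} []           = 1ℤ
δ {suc m} (inside  ∷ I) = 0ℤ
δ {suc m} (outside ∷ I) = δ I

⊛-cong-⊆ : ∀ {m} {f f′ g g′ : SubsetFn m} I →
           (∀ J → J ⊆ I → f J ≡ f′ J) → (∀ J → J ⊆ I → g J ≡ g′ J) →
           (f ⊛ g) I ≡ (f′ ⊛ g′) I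
⊛-cong-⊆ {zero} [] f≡ g≡ = cong₂ _*_ (f≡ [] (λ x → x)) (g≡ [] (λ x → x))
⊛-cong-⊆ {suc m} (inside ∷ I) f≡ g≡ =
  cong₂ _+_ (⊛-cong-⊆ I (λ J s → f≡ _ (s⊆s s)) (λ J s → g≡ _ (out⊆ s)))
            (⊛-cong-⊆ I (λ J s → f≡ _ (out⊆ s)) (λ J s → g≡ _ (s⊆s s)))
⊛-cong-⊆ {suc m} (outside ∷ I) f≡ g≡ =
  ⊛-cong-⊆ I (λ J s → f≡ _ (out⊆ s)) (λ J s → g≡ _ (out⊆ s))

⊛-cong : ∀ {m} {f f′ g g′ : SubsetFn m} → (∀ J → f J ≡ f′ J) → (∀ J → g J ≡ g′ J) →
         ∀ I → (f ⊛ g) I ≡ (f′ ⊛ g′) I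
⊛-cong f≡ g≡ I = ⊛-cong-⊆ I (λ J _ → f≡ J) (λ J _ → g≡ J)

⊛-comm : ∀ {m} (f g : SubsetFn m) I → (f ⊛ g) I ≡ (g ⊛ f) I
⊛-comm {zero} f g [] = ℤ.*-comm (f []) (g [])
⊛-comm {suc m} f g (inside ∷ I) =
  trans (cong₂ _+_ (⊛-comm (headIn f) (headOut g) I) (⊛-comm (headOut f) (headIn g) I))
        (ℤ.+-comm ((headOut g ⊛ headIn f) I) ((headIn g ⊛ headOut f) I))
⊛-comm {suc m} f g (outside ∷ I) = ⊛-comm (headOut f) (headOut g) I

⊛-distribʳ-⊕ : ∀ {m} (f f′ g : SubsetFn m) I → ((f ⊕ f′) ⊛ g) I ≡ (f ⊛ g) I + (f′ ⊛ g) I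
⊛-distribʳ-⊕ {zero} f f′ g [] = ℤ.*-distribʳ-+ (g []) (f []) (f′ [])
⊛-distribʳ-⊕ {suc m} f f′ g (inside ∷ I) =
  trans (cong₂ _+_ (⊛-distribʳ-⊕ (headIn f) (headIn f′) (headOut g) I)
                   (⊛-distribʳ-⊕ (headOut f) (headOut f′) (headIn g) I))
        (+-interchange ((fᵢ ⊛ gₒ) I) ((fᵢ′ ⊛ gₒ) I) ((fₒ ⊛ gᵢ) I) ((fₒ′ ⊛ gᵢ) I))
  where
  fᵢ = headIn f; fₒ = headOut f; fᵢ′ = headIn f′; fₒ′ = headOut f′; gᵢ = headIn g; gₒ = headOut g
⊛-distribʳ-⊕ {suc m} f f′ g (outside ∷ I) = ⊛-distribʳ-⊕ (headOut f) (headOut f′) (headOut g) I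

⊛-distribˡ-⊕ : ∀ {m} (f g g′ : SubsetFn m) I → (f ⊛ (g ⊕ g′)) I ≡ (f ⊛ g) I + (f ⊛ g′) I
⊛-distribˡ-⊕ f g g′ I = begin
  (f ⊛ (g ⊕ g′)) I          ≡⟨ ⊛-comm f (g ⊕ g′) I ⟩
  ((g ⊕ g′) ⊛ f) I          ≡⟨ ⊛-distribʳ-⊕ g g′ f I ⟩
  (g ⊛ f) I + (g′ ⊛ f) I    ≡⟨ cong₂ _+_ (⊛-comm g f I) (⊛-comm g′ f I) ⟩
  (f ⊛ g) I + (f ⊛ g′) I    ∎

⊛-·ʳ : ∀ {m} (a : ℤ) (f g : SubsetFn m) I → (f ⊛ (a · g)) I ≡ a * (f ⊛ g) I
⊛-·ʳ {zero} a f g [] = *-swapˡ (f []) a (g [])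
⊛-·ʳ {suc m} a f g (inside ∷ I) =
  trans (cong₂ _+_ (⊛-·ʳ a (headIn f) (headOut g) I) (⊛-·ʳ a (headOut f) (headIn g) I))
        (sym (ℤ.*-distribˡ-+ a _ _))
⊛-·ʳ {suc m} a f g (outside ∷ I) = ⊛-·ʳ a (headOut f) (headOut g) I

⊛-zeroʳ : ∀ {m} (f : SubsetFn m) I → (f ⊛ (λ _ → 0ℤ)) I ≡ 0ℤ
⊛-zeroʳ {zero} f [] = ℤ.*-zeroʳ (f [])
⊛-zeroʳ {suc m} f (inside ∷ I) = cong₂ _+_ (⊛-zeroʳ (headIn f) I) (⊛-zeroʳ (headOut f) I)
⊛-zeroʳ {suc m} f (outside ∷ I) = ⊛-zeroʳ (headOut f) I

⊛-identityˡ : ∀ {m} (g : SubsetFn m) I → (δ ⊛ g) I ≡ g I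
⊛-identityˡ {zero} g [] = ℤ.*-identityˡ (g [])
⊛-identityˡ {suc m} g (inside ∷ I) = begin
  ((λ _ → 0ℤ) ⊛ headOut g) I + (δ ⊛ headIn g) I
    ≡⟨ cong₂ _+_ (trans (⊛-comm _ (headOut g) I) (⊛-zeroʳ (headOut g) I)) (⊛-identityˡ (headIn g) I) ⟩
  0ℤ + g (inside ∷ I)
    ≡⟨ ℤ.+-identityˡ _ ⟩
  g (inside ∷ I)
    ∎
⊛-identityˡ {suc m} g (outside ∷ I) = ⊛-identityˡ (headOut g) I

⊛-identityʳ : ∀ {m} (f : SubsetFn m) I → (f ⊛ δ) I ≡ f I
⊛-identityʳ f I = trans (⊛-comm f δ I) (⊛-identityˡ f I)

⊛-assoc : ∀ {m} (f g h : SubsetFn m) I → ((f ⊛ g) ⊛ h) I ≡ (f ⊛ (g ⊛ h)) I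
⊛-assoc {zero} f g h [] = ℤ.*-assoc (f []) (g []) (h [])
⊛-assoc {suc m} f g h (inside ∷ I) = begin
  ((fᵢ ⊛ gₒ ⊕ fₒ ⊛ gᵢ) ⊛ hₒ) I + ((fₒ ⊛ gₒ) ⊛ hᵢ) I
    ≡⟨ cong (_+ ((fₒ ⊛ gₒ) ⊛ hᵢ) I) (⊛-distribʳ-⊕ (fᵢ ⊛ gₒ) (fₒ ⊛ gᵢ) hₒ I) ⟩
  ((fᵢ ⊛ gₒ) ⊛ hₒ) I + ((fₒ ⊛ gᵢ) ⊛ hₒ) I + ((fₒ ⊛ gₒ) ⊛ hᵢ) I
    ≡⟨ cong₂ _+_ (cong₂ _+_ (⊛-assoc fᵢ gₒ hₒ I) (⊛-assoc fₒ gᵢ hₒ I)) (⊛-assoc fₒ gₒ hᵢ I) ⟩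
  (fᵢ ⊛ (gₒ ⊛ hₒ)) I + (fₒ ⊛ (gᵢ ⊛ hₒ)) I + (fₒ ⊛ (gₒ ⊛ hᵢ)) I
    ≡⟨ ℤ.+-assoc ((fᵢ ⊛ (gₒ ⊛ hₒ)) I) _ _ ⟩
  (fᵢ ⊛ (gₒ ⊛ hₒ)) I + ((fₒ ⊛ (gᵢ ⊛ hₒ)) I + (fₒ ⊛ (gₒ ⊛ hᵢ)) I)
    ≡⟨ cong (_+_ ((fᵢ ⊛ (gₒ ⊛ hₒ)) I)) (sym (⊛-distribˡ-⊕ fₒ (gᵢ ⊛ hₒ) (gₒ ⊛ hᵢ) I)) ⟩
  (fᵢ ⊛ (gₒ ⊛ hₒ)) I + (fₒ ⊛ (gᵢ ⊛ hₒ ⊕ gₒ ⊛ hᵢ)) I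
    ∎
  where
  fᵢ = headIn f; fₒ = headOut f; gᵢ = headIn g; gₒ = headOut g; hᵢ = headIn h; hₒ = headOut h
⊛-assoc {suc m} f g h (outside ∷ I) = ⊛-assoc (headOut f) (headOut g) (headOut h) I

⊛-inverse-unique : ∀ {m} {f g h : SubsetFn m} I →
                   (∀ J → J ⊆ I → (f ⊛ g) J ≡ δ J) → (∀ J → J ⊆ I → (g ⊛ h) J ≡ δ J) →
                   f I ≡ h I
⊛-inverse-unique {f = f} {g} {h} I fg≡δ gh≡δ = begin
  f I                ≡⟨ sym (⊛-identityʳ f I) ⟩
  (f ⊛ δ) I          ≡⟨ ⊛-cong-⊆ I (λ _ _ → refl) (λ J J⊆I → sym (gh≡δ J J⊆I)) ⟩
  (f ⊛ (g ⊛ h)) I    ≡⟨ sym (⊛-assoc f g h I) ⟩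
  ((f ⊛ g) ⊛ h) I    ≡⟨ ⊛-cong-⊆ I fg≡δ (λ _ _ → refl) ⟩
  (δ ⊛ h) I          ≡⟨ ⊛-identityˡ h I ⟩
  h I                ∎

alternating : ∀ {m} → SubsetFn m
alternating J = sign ∣ J ∣

signed : ∀ {m} → SubsetFn m → SubsetFn m
signed f J = alternating J * f J

one : ∀ {m} → SubsetFn m
one _ = 1ℤ

one⊛alternating≡δ : ∀ {m} I → (one ⊛ alternating {m}) I ≡ δ I
one⊛alternating≡δ {zero} [] = refl
one⊛alternating≡δ {suc m} (inside ∷ I) = begin
  (one ⊛ alternating) I + (one ⊛ (λ J → - alternating J)) I
    ≡⟨ cong₂ _+_ (one⊛alternating≡δ I) (⊛-cong (λ _ → refl) (λ J → sym (ℤ.-1*i≡-i (alternating J))) I) ⟩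
  δ I + (one ⊛ (-1ℤ · alternating)) I    ≡⟨ cong (_+_ (δ I)) (⊛-·ʳ -1ℤ one alternating I) ⟩
  δ I + -1ℤ * (one ⊛ alternating) I      ≡⟨ cong (λ x → δ I + -1ℤ * x) (one⊛alternating≡δ I) ⟩
  δ I + -1ℤ * δ I                        ≡⟨ cong (_+_ (δ I)) (ℤ.-1*i≡-i (δ I)) ⟩
  δ I - δ I                              ≡⟨ ℤ.+-inverseʳ (δ I) ⟩
  0ℤ                                     ∎
one⊛alternating≡δ {suc m} (outside ∷ I) = one⊛alternating≡δ I

module _ {A : Set} where

  sumℤ-++ : ∀ (h : A → ℤ) xs ys → sumℤ (map h (xs ++ ys)) ≡ sumℤ (map h xs) + sumℤ (map h ys)
  sumℤ-++ h []       ys = sym (ℤ.+-identityˡ _)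
  sumℤ-++ h (x ∷ xs) ys = trans (cong (_+_ (h x)) (sumℤ-++ h xs ys)) (sym (ℤ.+-assoc (h x) _ _))

  sumℤ-cong : ∀ {h h′ : A → ℤ} → (∀ x → h x ≡ h′ x) → ∀ xs → sumℤ (map h xs) ≡ sumℤ (map h′ xs)
  sumℤ-cong h≡ []       = refl
  sumℤ-cong h≡ (x ∷ xs) = cong₂ _+_ (h≡ x) (sumℤ-cong h≡ xs)

  sumℤ-zero : ∀ {h : A → ℤ} → (∀ x → h x ≡ 0ℤ) → ∀ xs → sumℤ (map h xs) ≡ 0ℤ
  sumℤ-zero h≡0 []       = refl
  sumℤ-zero h≡0 (x ∷ xs) = cong₂ _+_ (h≡0 x) (sumℤ-zero h≡0 xs)

  sumℤ-+ : ∀ (h h′ : A → ℤ) xs →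
           sumℤ (map (λ x → h x + h′ x) xs) ≡ sumℤ (map h xs) + sumℤ (map h′ xs)
  sumℤ-+ h h′ []       = refl
  sumℤ-+ h h′ (x ∷ xs) =
    trans (cong (_+_ (h x + h′ x)) (sumℤ-+ h h′ xs)) (+-interchange (h x) (h′ x) _ _)

  sumℤ-filter : ∀ {P : Pred A 0ℓ} (P? : Decidable P) (h : A → ℤ) xs →
                sumℤ (map h (filter P? xs)) ≡ sumℤ (map (λ x → if does (P? x) then h x else 0ℤ) xs)
  sumℤ-filter P? h []       = refl
  sumℤ-filter P? h (x ∷ xs) with does (P? x)
  ... | true  = cong (_+_ (h x)) (sumℤ-filter P? h xs)
  ... | false = trans (sumℤ-filter P? h xs) (sym (ℤ.+-identityˡ _))

  sumℤ-concatMap : ∀ {B : Set} (h : A → ℤ) (F : B → List A) xs →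
                   sumℤ (map h (concatMap F xs)) ≡ sumℤ (map (λ x → sumℤ (map h (F x))) xs)
  sumℤ-concatMap h F []       = refl
  sumℤ-concatMap h F (x ∷ xs) =
    trans (sumℤ-++ h (F x) (concatMap F xs))
          (cong (_+_ (sumℤ (map h (F x)))) (sumℤ-concatMap h F xs))

sumSubsets : ∀ m → SubsetFn m → ℤ
sumSubsets m h = sumℤ (map h (allSubsets m))

sumSubsets-suc : ∀ {m} (h : SubsetFn (suc m)) →
                 sumSubsets (suc m) h ≡ sumSubsets m (headIn h) + sumSubsets m (headOut h)
sumSubsets-suc {m} h = begin
  sumSubsets (suc m) h
    ≡⟨ sumℤ-concatMap h (λ J → (inside ∷ J) ∷ (outside ∷ J) ∷ []) (allSubsets m) ⟩
  sumSubsets m (λ J → headIn h J + (headOut h J + 0ℤ))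
    ≡⟨ sumℤ-cong (λ J → cong (_+_ (headIn h J)) (ℤ.+-identityʳ (headOut h J))) (allSubsets m) ⟩
  sumSubsets m (headIn h ⊕ headOut h)
    ≡⟨ sumℤ-+ (headIn h) (headOut h) (allSubsets m) ⟩
  sumSubsets m (headIn h) + sumSubsets m (headOut h)
    ∎

⊛-term : ∀ {m} → SubsetFn m → SubsetFn m → Subset m → SubsetFn m
⊛-term f g I J = if does (J ⊆? I) then f J * g (I ─ J) else 0ℤ

⊛-as-sum : ∀ {m} (f g : SubsetFn m) I → (f ⊛ g) I ≡ sumSubsets m (⊛-term f g I)
⊛-as-sum {zero} f g [] = sym (ℤ.+-identityʳ _)
⊛-as-sum {suc m} f g (inside ∷ I) =
  trans (cong₂ _+_ (⊛-as-sum (headIn f) (headOut g) I) (⊛-as-sum (headOut f) (headIn g) I))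
        (sym (sumSubsets-suc (⊛-term f g (inside ∷ I))))
⊛-as-sum {suc m} f g (outside ∷ I) = begin
  (headOut f ⊛ headOut g) I
    ≡⟨ ⊛-as-sum (headOut f) (headOut g) I ⟩
  sumSubsets m (headOut term)
    ≡⟨ sym (ℤ.+-identityˡ _) ⟩
  0ℤ + sumSubsets m (headOut term)
    ≡⟨ cong (_+ sumSubsets m (headOut term)) (sym (sumℤ-zero (λ _ → refl) (allSubsets m))) ⟩
  sumSubsets m (headIn term) + sumSubsets m (headOut term)
    ≡⟨ sym (sumSubsets-suc term) ⟩
  sumSubsets (suc m) term
    ∎
  where
  term = ⊛-term f g (outside ∷ I)

VanishesBelow : ∀ {m} → ℕ → SubsetFn m → Set
VanishesBelow k g = ∀ J → ∣ J ∣ < k → g J ≡ 0ℤ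

-- A nonempty J ⊆ I leaves ∣ I ─ J ∣ < ∣ I ∣, and the empty J is killed by f ⊥ ≡ 0ℤ.
⊛-vanishesBelow : ∀ {m k} {f g : SubsetFn m} →
                  f ⊥ ≡ 0ℤ → VanishesBelow k g → VanishesBelow (suc k) (f ⊛ g)
⊛-vanishesBelow {m} {k} {f} {g} f⊥≡0 g≡0 I ∣I∣≤k =
  trans (⊛-as-sum f g I) (sumℤ-zero term≡0 (allSubsets m))
  where
  term≡0 : ∀ J → ⊛-term f g I J ≡ 0ℤ
  term≡0 J with J ⊆? I | nonempty? J
  ... | no _    | _ = refl
  ... | yes J⊆I | yes (x , x∈J) =
    trans (cong (f J *_) (g≡0 (I ─ J) (<-≤-trans ∣I─J∣<∣I∣ (≤-pred ∣I∣≤k)))) (ℤ.*-zeroʳ (f J))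
    where ∣I─J∣<∣I∣ = p∩q≢∅⇒∣p─q∣<∣p∣ I J (x , x∈p∩q⁺ (J⊆I x∈J , x∈J))
  ... | yes _   | no J≡∅ = cong (_* g (I ─ J)) (trans (cong f (Empty-unique J≡∅)) f⊥≡0)

δ-nonempty : ∀ {m} {I : Subset m} → Nonempty I → δ I ≡ 0ℤ
δ-nonempty {I = inside  ∷ I} _               = refl
δ-nonempty {I = outside ∷ I} (zero  , ())
δ-nonempty {I = outside ∷ I} (suc x , there x∈I) = δ-nonempty (x , x∈I)

δ-⊥ : ∀ {m} → δ {m} ⊥ ≡ 1ℤ
δ-⊥ {zero} = refl
δ-⊥ {suc m}  = δ-⊥ {m}

δ-empty : ∀ {m} {I : Subset m} → Empty I → δ I ≡ 1ℤ
δ-empty {m} I≡∅ = trans (cong δ (Empty-unique I≡∅)) (δ-⊥ {m})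

εK≡δ : ∀ {m} (I : Subset m) → εK I ≡ δ I
εK≡δ I with nonempty? I
... | yes I≢∅ = sym (δ-nonempty I≢∅)
... | no  I≡∅ = sym (δ-empty I≡∅)

∪≡⊥⁻ : ∀ {m} {p q : Subset m} → p ∪ q ≡ ⊥ → p ≡ ⊥ × q ≡ ⊥
∪≡⊥⁻ {p = p} {q} p∪q≡⊥ =
  ⊆-antisym (λ x∈p → subst (_ ∈_) p∪q≡⊥ (p⊆p∪q q x∈p)) ⊥⊆ ,
  ⊆-antisym (λ x∈q → subst (_ ∈_) p∪q≡⊥ (q⊆p∪q p q x∈q)) ⊥⊆

⋃ : ∀ {m} → List (Subset m) → Subset m
⋃ = foldr _∪_ ⊥

disjoint-⋃⁺ : ∀ {m} {J : Subset m} {L} → All (Disjoint J) L → Disjoint J (⋃ L)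
disjoint-⋃⁺ {J = J} []                  = ∩-zeroʳ J
disjoint-⋃⁺ {J = J} {B ∷ L} (J∩B≡⊥ ∷ ds) =
  trans (∩-distribˡ-∪ J B (⋃ L)) (trans (cong₂ _∪_ J∩B≡⊥ (disjoint-⋃⁺ ds)) (∪-identityˡ ⊥))

disjoint-⋃⁻ : ∀ {m} {J : Subset m} L → Disjoint J (⋃ L) → All (Disjoint J) L
disjoint-⋃⁻         []      _ = []
disjoint-⋃⁻ {J = J} (B ∷ L) J∩⋃≡⊥ with ∪≡⊥⁻ (trans (sym (∩-distribˡ-∪ J B (⋃ L))) J∩⋃≡⊥)
... | J∩B≡⊥ , J∩⋃L≡⊥ = J∩B≡⊥ ∷ disjoint-⋃⁻ L J∩⋃L≡⊥

∪─-cancelˡ : ∀ {m} (J U : Subset m) → Disjoint J U → (J ∪ U) ─ J ≡ U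
∪─-cancelˡ []            []            _  = refl
∪─-cancelˡ (outside ∷ J) (u ∷ U)       eq = cong (u ∷_) (∪─-cancelˡ J U (∷-injectiveʳ eq))
∪─-cancelˡ (inside ∷ J)  (outside ∷ U) eq = cong (outside ∷_) (∪─-cancelˡ J U (∷-injectiveʳ eq))
∪─-cancelˡ (inside ∷ J)  (inside ∷ U)  ()

disjoint-─ : ∀ {m} (J I : Subset m) → Disjoint J (I ─ J)
disjoint-─ []            []      = refl
disjoint-─ (inside ∷ J)  (_ ∷ I) = cong (outside ∷_) (disjoint-─ J I)
disjoint-─ (outside ∷ J) (_ ∷ I) = cong (outside ∷_) (disjoint-─ J I)

∪─-⊆ : ∀ {m} (J I : Subset m) → J ⊆ I → J ∪ (I ─ J) ≡ I
∪─-⊆ []            []            _   = refl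
∪─-⊆ (inside ∷ J)  (inside ∷ I)  J⊆I = cong (inside ∷_) (∪─-⊆ J I (drop-∷-⊆ J⊆I))
∪─-⊆ (inside ∷ J)  (outside ∷ I) J⊆I with J⊆I here
... | ()
∪─-⊆ (outside ∷ J) (i ∷ I)       J⊆I = cong (i ∷_) (∪─-⊆ J I (drop-∷-⊆ J⊆I))

module _ {A B : Set} {P : Pred B 0ℓ} {Q : Pred A 0ℓ} (P? : Decidable P) (Q? : Decidable Q)
         (f : A → B) (P∘f⇒Q : ∀ x → P (f x) → Q x) (Q⇒P∘f : ∀ x → Q x → P (f x)) where

  length-filter-map : ∀ xs → length (filter P? (map f xs)) ≡ length (filter Q? xs)
  length-filter-map []       = refl
  length-filter-map (x ∷ xs) with P? (f x) | Q? x
  ... | yes _    | yes _   = cong suc (length-filter-map xs)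
  ... | no  _    | no  _   = length-filter-map xs
  ... | yes Pfx  | no ¬Qx  = ⊥-elim (¬Qx (P∘f⇒Q x Pfx))
  ... | no  ¬Pfx | yes Qx  = ⊥-elim (¬Pfx (Q⇒P∘f x Qx))

length-filter-concatMap : ∀ {A B : Set} {P : Pred A 0ℓ} (P? : Decidable P) (F : B → List A) xs →
  + length (filter P? (concatMap F xs)) ≡ sumℤ (map (λ x → + length (filter P? (F x))) xs)
length-filter-concatMap P? F []       = refl
length-filter-concatMap P? F (x ∷ xs) = begin
  + length (filter P? (F x ++ concatMap F xs))
    ≡⟨ cong (+_ ∘ length) (filter-++ P? (F x) (concatMap F xs)) ⟩
  + length (filter P? (F x) ++ filter P? (concatMap F xs))
    ≡⟨ cong +_ (length-++ (filter P? (F x))) ⟩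
  + (length (filter P? (F x)) ℕ.+ length (filter P? (concatMap F xs)))
    ≡⟨ ℤ.pos-+ (length (filter P? (F x))) _ ⟩
  + length (filter P? (F x)) + + length (filter P? (concatMap F xs))
    ≡⟨ cong (_+_ (+ length (filter P? (F x)))) (length-filter-concatMap P? F xs) ⟩
  + length (filter P? (F x)) + sumℤ (map (λ x → + length (filter P? (F x))) xs)
    ∎

module _ {m : ℕ} (K : SimplicialComplex m) where

  IsBlock : Subset m → Subset m → Set
  IsBlock I J = J ⊆ I × Nonempty J × IsSimplex K J

  isBlock? : ∀ I J → Dec (IsBlock I J)
  isBlock? I J = (J ⊆? I) ×-dec nonempty? J ×-dec isSimplex? K J

  simplexPartition-∷⁻ : ∀ {k} {I J} {Is : Vec (Subset m) k} →
    IsSimplexPartition K I (J ∷ Is) → IsBlock I J × IsSimplexPartition K (I ─ J) Is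
  simplexPartition-∷⁻ {J = J} {Is} (J≢∅ ∷ nes , J#Is ∷ dis , J∪⋃Is≡I , Jsx ∷ sxs) =
    ((λ x∈J → subst (_ ∈_) J∪⋃Is≡I (p⊆p∪q (⋃ (toList Is)) x∈J)) , J≢∅ , Jsx) ,
    nes , dis , trans (sym (∪─-cancelˡ J _ (disjoint-⋃⁺ J#Is))) (cong (_─ J) J∪⋃Is≡I) , sxs

  simplexPartition-∷⁺ : ∀ {k} {I J} {Is : Vec (Subset m) k} →
    IsBlock I J → IsSimplexPartition K (I ─ J) Is → IsSimplexPartition K I (J ∷ Is)
  simplexPartition-∷⁺ {I = I} {J} {Is} (J⊆I , J≢∅ , Jsx) (nes , dis , ⋃Is≡I─J , sxs) =
    J≢∅ ∷ nes ,
    disjoint-⋃⁻ (toList Is) (subst (Disjoint J) (sym ⋃Is≡I─J) (disjoint-─ J I)) ∷ dis ,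
    trans (cong (J ∪_) ⋃Is≡I─J) (∪─-⊆ J I J⊆I) ,
    Jsx ∷ sxs

  count-∷-¬block : ∀ {k} {I J} (Iss : List (Vec (Subset m) k)) → ¬ IsBlock I J →
    length (filter (isSimplexPartition? K I) (map (J ∷_) Iss)) ≡ 0
  count-∷-¬block {I = I} Iss ¬block = cong length (filter-none (isSimplexPartition? K I)
    (map⁺ (universal (λ _ → ¬block ∘ proj₁ ∘ simplexPartition-∷⁻) Iss)))

  count-∷ : ∀ {k} I J (Iss : List (Vec (Subset m) k)) →
    length (filter (isSimplexPartition? K I) (map (J ∷_) Iss)) ≡
    (if does (isBlock? I J) then length (filter (isSimplexPartition? K (I ─ J)) Iss) else 0)
  count-∷ I J Iss with J ⊆? I | nonempty? J | isSimplex? K J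
  ... | yes J⊆I | yes J≢∅ | yes Jsx =
    length-filter-map (isSimplexPartition? K I) (isSimplexPartition? K (I ─ J)) (J ∷_)
      (λ _ → proj₂ ∘ simplexPartition-∷⁻) (λ _ → simplexPartition-∷⁺ (J⊆I , J≢∅ , Jsx)) Iss
  ... | yes _   | yes _   | no ¬Jsx = count-∷-¬block Iss (¬Jsx ∘ proj₂ ∘ proj₂)
  ... | yes _   | no J≡∅  | _       = count-∷-¬block Iss (J≡∅ ∘ proj₁ ∘ proj₂)
  ... | no ¬J⊆I | _       | _       = count-∷-¬block Iss (¬J⊆I ∘ proj₁)

  partitions : ℕ → SubsetFn m
  partitions k I = + numPartitions K I k

  ζ⁺ : SubsetFn m
  ζ⁺ J = if does (nonempty? J ×-dec isSimplex? K J) then 1ℤ else 0ℤ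

  ζ⁺-⊥ : ζ⁺ ⊥ ≡ 0ℤ
  ζ⁺-⊥ with nonempty? (⊥ {m})
  ... | yes (_ , x∈⊥) = ⊥-elim (∉⊥ x∈⊥)
  ... | no  _         = refl

  partitions-zero : ∀ I → partitions 0 I ≡ δ I
  partitions-zero I with isSimplexPartition? K I [] | nonempty? I
  ... | yes (_ , _ , ⊥≡I , _) | yes (_ , x∈I) = ⊥-elim (∉⊥ (subst (_ ∈_) (sym ⊥≡I) x∈I))
  ... | yes partition         | no  I≡∅       =
    trans (cong (+_ ∘ length) (filter-accept (isSimplexPartition? K I) partition))
          (sym (δ-empty I≡∅))
  ... | no  ¬partition        | yes I≢∅       =
    trans (cong (+_ ∘ length) (filter-reject (isSimplexPartition? K I) ¬partition))
          (sym (δ-nonempty I≢∅))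
  ... | no  ¬partition        | no  I≡∅       =
    ⊥-elim (¬partition ([] , [] , sym (Empty-unique I≡∅) , []))

  -- Splitting off the first block J of an ordered partition of I leaves one of I ─ J.
  partitions-suc : ∀ k I → partitions (suc k) I ≡ (ζ⁺ ⊛ partitions k) I
  partitions-suc k I = begin
    partitions (suc k) I
      ≡⟨ length-filter-concatMap (isSimplexPartition? K I) withFirstBlock (allSubsets m) ⟩
    sumSubsets m (λ J → + length (filter (isSimplexPartition? K I) (withFirstBlock J)))
      ≡⟨ sumℤ-cong (λ J → trans (cong +_ (count-∷ I J (allTuples m k))) (firstBlock J))
                   (allSubsets m) ⟩
    sumSubsets m (⊛-term ζ⁺ (partitions k) I)
      ≡⟨ sym (⊛-as-sum ζ⁺ (partitions k) I) ⟩
    (ζ⁺ ⊛ partitions k) I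
      ∎
    where
    withFirstBlock : Subset m → List (Vec (Subset m) (suc k))
    withFirstBlock J = map (J ∷_) (allTuples m k)
    firstBlock : ∀ J → + (if does (isBlock? I J) then numPartitions K (I ─ J) k else 0) ≡
                       ⊛-term ζ⁺ (partitions k) I J
    firstBlock J with J ⊆? I | nonempty? J | isSimplex? K J
    ... | yes _ | yes _ | yes _ = sym (ℤ.*-identityˡ _)
    ... | yes _ | yes _ | no  _ = refl
    ... | yes _ | no  _ | _     = refl
    ... | no  _ | _     | _     = refl

  partitions-vanishesBelow : ∀ k → VanishesBelow k (partitions k)
  partitions-vanishesBelow zero  J ()
  partitions-vanishesBelow (suc k) J ∣J∣≤k =
    trans (partitions-suc k J) (⊛-vanishesBelow ζ⁺-⊥ (partitions-vanishesBelow k) J ∣J∣≤k)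

  alternatingPartitions : ℕ → SubsetFn m
  alternatingPartitions k I = sumℤ (map (λ j → sign j * partitions j I) (upTo k))

  alternatingPartitions-suc : ∀ k I →
    alternatingPartitions (suc k) I ≡ alternatingPartitions k I + sign k * partitions k I
  alternatingPartitions-suc k I = begin
    sumℤ (map term (upTo (suc k)))   ≡⟨ cong (sumℤ ∘ map term) (sym (upTo-∷ʳ k)) ⟩
    sumℤ (map term (upTo k ∷ʳ k))    ≡⟨ sumℤ-++ term (upTo k) (k ∷ []) ⟩
    Σ<k + (term k + 0ℤ)              ≡⟨ cong (_+_ Σ<k) (ℤ.+-identityʳ (term k)) ⟩
    Σ<k + term k                     ∎
    where
    term : ℕ → ℤ
    term j = sign j * partitions j I
    Σ<k = alternatingPartitions k I

  ζK-simplex : ∀ {J} → IsSimplex K J → ζK K J ≡ 1ℤ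
  ζK-simplex {J} Jsx with isSimplex? K J
  ... | yes _    = refl
  ... | no ¬Jsx = ⊥-elim (¬Jsx Jsx)

  signed-nonsimplex : ∀ {J} → ¬ IsSimplex K J → signed (ζK K) J ≡ 0ℤ
  signed-nonsimplex {J} ¬Jsx with isSimplex? K J
  ... | yes Jsx = ⊥-elim (¬Jsx Jsx)
  ... | no  _   = ℤ.*-zeroʳ (alternating J)

  χK≡signed⊛ζK : ∀ I → χK K I ≡ (signed (ζK K) ⊛ ζK K) I
  χK≡signed⊛ζK I = begin
    χK K I
      ≡⟨ sumℤ-filter (_⊆? I) (λ J → sign ∣ J ∣ * (ζK K J * ζK K (I ─ J))) (allSubsets m) ⟩
    sumSubsets m (λ J → if does (J ⊆? I) then sign ∣ J ∣ * (ζK K J * ζK K (I ─ J)) else 0ℤ)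
      ≡⟨ sumℤ-cong (λ J → cong (λ x → if does (J ⊆? I) then x else 0ℤ) (sym (reassoc J))) (allSubsets m) ⟩
    sumSubsets m (⊛-term (signed (ζK K)) (ζK K) I)
      ≡⟨ sym (⊛-as-sum (signed (ζK K)) (ζK K) I) ⟩
    (signed (ζK K) ⊛ ζK K) I
      ∎
    where
    reassoc : ∀ J → alternating J * ζK K J * ζK K (I ─ J) ≡ alternating J * (ζK K J * ζK K (I ─ J))
    reassoc J = ℤ.*-assoc (alternating J) (ζK K J) (ζK K (I ─ J))

  signed⊛ζK-simplex : ∀ {I} → IsSimplex K I → ∀ J → J ⊆ I → (signed (ζK K) ⊛ ζK K) J ≡ δ J
  signed⊛ζK-simplex Isx J J⊆I = begin
    (signed (ζK K) ⊛ ζK K) J  ≡⟨ ⊛-cong-⊆ J signed≡alternating ζK≡1 ⟩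
    (alternating ⊛ one) J     ≡⟨ ⊛-comm alternating one J ⟩
    (one ⊛ alternating) J     ≡⟨ one⊛alternating≡δ J ⟩
    δ J                       ∎
    where
    ζK≡1 : ∀ L → L ⊆ J → ζK K L ≡ 1ℤ
    ζK≡1 L L⊆J = ζK-simplex (λ σ σ⊆L → Isx σ (⊆-trans σ⊆L (⊆-trans L⊆J J⊆I)))
    signed≡alternating : ∀ L → L ⊆ J → signed (ζK K) L ≡ alternating L
    signed≡alternating L L⊆J = trans (cong (alternating L *_) (ζK≡1 L L⊆J)) (ℤ.*-identityʳ _)

  module _ (∅∈K : Face K ⊥) where

    nonsimplex⇒nonempty : ∀ {J} → ¬ IsSimplex K J → Nonempty J
    nonsimplex⇒nonempty {J} ¬Jsx with nonempty? J
    ... | yes J≢∅ = J≢∅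
    ... | no  J≡∅ = ⊥-elim (¬Jsx (subst (IsSimplex K) (sym (Empty-unique J≡∅)) ⊥-isSimplex))
      where
      ⊥-isSimplex : IsSimplex K ⊥
      ⊥-isSimplex σ σ⊆⊥ = downClosed K σ⊆⊥ ∅∈K

    ζK≡δ⊕ζ⁺ : ∀ J → ζK K J ≡ (δ ⊕ ζ⁺) J
    ζK≡δ⊕ζ⁺ J with nonempty? J | isSimplex? K J
    ... | yes J≢∅ | yes _   = trans (sym (ℤ.+-identityˡ 1ℤ)) (cong (_+ 1ℤ) (sym (δ-nonempty J≢∅)))
    ... | yes J≢∅ | no  _   = sym (trans (ℤ.+-identityʳ (δ J)) (δ-nonempty J≢∅))
    ... | no  J≡∅ | yes _   = sym (trans (ℤ.+-identityʳ (δ J)) (δ-empty J≡∅))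
    ... | no  J≡∅ | no ¬Jsx = ⊥-elim (J≡∅ (nonsimplex⇒nonempty ¬Jsx))

    ζK⊛partitions : ∀ k I → (ζK K ⊛ partitions k) I ≡ partitions k I + partitions (suc k) I
    ζK⊛partitions k I = begin
      (ζK K ⊛ partitions k) I                       ≡⟨ ⊛-cong ζK≡δ⊕ζ⁺ (λ _ → refl) I ⟩
      ((δ ⊕ ζ⁺) ⊛ partitions k) I                   ≡⟨ ⊛-distribʳ-⊕ δ ζ⁺ (partitions k) I ⟩
      (δ ⊛ partitions k) I + (ζ⁺ ⊛ partitions k) I  ≡⟨ cong₂ _+_ (⊛-identityˡ (partitions k) I)
                                                                 (sym (partitions-suc k I)) ⟩
      partitions k I + partitions (suc k) I         ∎

    ζK⊛alternatingPartitions : ∀ k I →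
      (ζK K ⊛ alternatingPartitions k) I ≡ δ I - sign k * partitions k I
    ζK⊛alternatingPartitions zero I = begin
      (ζK K ⊛ (λ _ → 0ℤ)) I      ≡⟨ ⊛-zeroʳ (ζK K) I ⟩
      0ℤ                         ≡⟨ sym (ℤ.+-inverseʳ (δ I)) ⟩
      δ I - δ I                  ≡⟨ cong (_-_ (δ I)) (sym (partitions-zero I)) ⟩
      δ I - partitions 0 I       ≡⟨ cong (_-_ (δ I)) (sym (ℤ.*-identityˡ (partitions 0 I))) ⟩
      δ I - 1ℤ * partitions 0 I  ∎
    ζK⊛alternatingPartitions (suc k) I = begin
      (ζK K ⊛ alternatingPartitions (suc k)) I
        ≡⟨ ⊛-cong (λ _ → refl) (alternatingPartitions-suc k) I ⟩
      (ζK K ⊛ (alternatingPartitions k ⊕ s · partitions k)) I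
        ≡⟨ ⊛-distribˡ-⊕ (ζK K) (alternatingPartitions k) (s · partitions k) I ⟩
      (ζK K ⊛ alternatingPartitions k) I + (ζK K ⊛ s · partitions k) I
        ≡⟨ cong₂ _+_ (ζK⊛alternatingPartitions k I) (⊛-·ʳ s (ζK K) (partitions k) I) ⟩
      (δ I - s * partitions k I) + s * (ζK K ⊛ partitions k) I
        ≡⟨ cong (λ x → (δ I - s * partitions k I) + s * x) (ζK⊛partitions k I) ⟩
      (δ I - s * partitions k I) + s * (partitions k I + partitions (suc k) I)
        ≡⟨ telescope (δ I) s (partitions k I) (partitions (suc k) I) ⟩
      δ I - - s * partitions (suc k) I
        ∎
      where
      s = sign k
      telescope : ∀ d s n n′ → (d - s * n) + s * (n + n′) ≡ d - - s * n′
      telescope = solve-∀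

    ζK⊛ζKinv : ∀ I → (ζK K ⊛ ζKinv K) I ≡ δ I
    ζK⊛ζKinv I = begin
      (ζK K ⊛ ζKinv K) I                    ≡⟨ ζK⊛alternatingPartitions (suc m) I ⟩
      δ I - sign (suc m) * partitions (suc m) I
        ≡⟨ cong (λ x → δ I - sign (suc m) * x) (partitions-vanishesBelow (suc m) I ∣I∣<1+m) ⟩
      δ I - sign (suc m) * 0ℤ               ≡⟨ cong (_-_ (δ I)) (ℤ.*-zeroʳ (sign (suc m))) ⟩
      δ I + 0ℤ                              ≡⟨ ℤ.+-identityʳ (δ I) ⟩
      δ I                                   ∎
      where
      ∣I∣<1+m : ∣ I ∣ < suc m
      ∣I∣<1+m = s≤s (∣p∣≤n I)

    ζKinv-simplex : ∀ {I} → IsSimplex K I → ζKinv K I ≡ signed (ζK K) I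
    ζKinv-simplex {I} Isx = sym (⊛-inverse-unique I (signed⊛ζK-simplex Isx) (λ J _ → ζK⊛ζKinv J))

    eulerian⇒ : Eulerian K → ∀ I → Nonempty I → IsSimplex K I ⊎ ζKinv K I ≡ 0ℤ
    eulerian⇒ eulerian I _ with toSum (isSimplex? K I)
    ... | inj₁ Isx  = inj₁ Isx
    ... | inj₂ ¬Isx = inj₂ (begin
      ζKinv K I        ≡⟨ sym (⊛-inverse-unique I (λ J _ → signed⊛ζK≡δ J) (λ J _ → ζK⊛ζKinv J)) ⟩
      signed (ζK K) I  ≡⟨ signed-nonsimplex ¬Isx ⟩
      0ℤ               ∎)
      where
      signed⊛ζK≡δ : ∀ J → (signed (ζK K) ⊛ ζK K) J ≡ δ J
      signed⊛ζK≡δ J = trans (sym (χK≡signed⊛ζK J)) (trans (eulerian J) (εK≡δ J))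

    ⇒eulerian : (∀ I → Nonempty I → IsSimplex K I ⊎ ζKinv K I ≡ 0ℤ) → Eulerian K
    ⇒eulerian simplex⊎ζKinv≡0 I = begin
      χK K I                    ≡⟨ χK≡signed⊛ζK I ⟩
      (signed (ζK K) ⊛ ζK K) I  ≡⟨ ⊛-cong signed≡ζKinv (λ _ → refl) I ⟩
      (ζKinv K ⊛ ζK K) I        ≡⟨ ⊛-comm (ζKinv K) (ζK K) I ⟩
      (ζK K ⊛ ζKinv K) I        ≡⟨ ζK⊛ζKinv I ⟩
      δ I                       ≡⟨ sym (εK≡δ I) ⟩
      εK I                      ∎
      where
      signed≡ζKinv : ∀ J → signed (ζK K) J ≡ ζKinv K J
      signed≡ζKinv J with toSum (isSimplex? K J)
      ... | inj₁ Jsx  = sym (ζKinv-simplex Jsx)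
      ... | inj₂ ¬Jsx with simplex⊎ζKinv≡0 J (nonsimplex⇒nonempty ¬Jsx)
      ...   | inj₁ Jsx      = ⊥-elim (¬Jsx Jsx)
      ...   | inj₂ ζKinv≡0 = trans (signed-nonsimplex ¬Jsx) (sym ζKinv≡0)

mainTheorem7 : (n : ℕ) (K : SimplicialComplex (suc n)) →
    (Eulerian K → (I : Subset (suc n)) → Nonempty I → IsSimplex K I ⊎ ζKinv K I ≡ 0ℤ) ×
    (((I : Subset (suc n)) → Nonempty I → IsSimplex K I ⊎ ζKinv K I ≡ 0ℤ) → Eulerian K)
mainTheorem7 n K = eulerian⇒ K ∅∈K , ⇒eulerian K ∅∈K
  where
  ∅∈K : Face K ⊥
  ∅∈K = downClosed K ⊥⊆ (singletons K zero)
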